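{- Let $n\ge 3$ and $v\in V(C_n)$. Then $$DV_{C_n}(v)=\begin{cases}1 & \text{if } n\equiv 0\pmod 3,\\ \frac12\lceil\frac n3\rceil\left(1+\lceil \frac n3\rceil\right) & \text{if } n\equiv 1\pmod 3,\\ \lceil \frac n3\rceil & \text{if } n\equiv 2\pmod 3.\end{cases}$$
   Context: All graphs are finite, simple and undirected; $C_n$ is the cycle on $n$ vertices. A set $D\subseteq V(G)$ is a dominating set of $G$ if every vertex not in $D$ is adjacent to at least one vertex of $D$. The domination number $\gamma(G)$ is the minimum cardinality of a dominating set; a dominating set of cardinality $\gamma(G)$ is a $\gamma(G)$-set. For $v\in V(G)$, $DV_G(v)$ (the domination value of $v$) is the number of $\gamma(G)$-sets containing $v$. -}

module Defs where

open import Data.Nat using (ℕ; zero; suc; _+_; _⊓_; _≡ᵇ_)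
open import Data.Bool using (Bool; true; false; _∧_; _∨_; not)
open import Data.Fin using (Fin; toℕ)
open import Data.Fin.Subset using (Subset; ∣_∣; inside; outside)
open import Data.Vec using (Vec; []; _∷_; lookup)
open import Data.List using (List; []; _∷_; map; _++_; length; foldr; allFin; filterᵇ)
open import Data.Bool.ListAction using (all; any)
open import Data.Nat.DivMod using (_%_; _/_)
open import Relation.Binary.PropositionalEquality using (_≡_)

-- A graph on vertex set Fin n, given by its Boolean adjacency relation
-- (for the cycles used below it is irreflexive and symmetric when n ≥ 3).
Graph : ℕ → Set
Graph n = Fin n → Fin n → Bool

memᵇ : {n : ℕ} → Fin n → Subset n → Bool
memᵇ i S with lookup S i
... | inside  = true
... | outside = false

allSubsets : (n : ℕ) → List (Subset n)
allSubsets zero    = [] ∷ []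
allSubsets (suc n) = map (outside ∷_) (allSubsets n) ++ map (inside ∷_) (allSubsets n)

isDominating : {n : ℕ} → Graph n → Subset n → Bool
isDominating {n} G D =
  all (λ u → memᵇ u D ∨ any (λ w → memᵇ w D ∧ G u w) (allFin n)) (allFin n)

dominatingSets : {n : ℕ} → Graph n → List (Subset n)
dominatingSets {n} G = filterᵇ (isDominating G) (allSubsets n)

-- domination number: minimum cardinality of a dominating set
-- (V(G) itself is dominating, so the minimum is over a nonempty family; n is a valid start value)
γ : {n : ℕ} → Graph n → ℕ
γ {n} G = foldr (λ D m → ∣ D ∣ ⊓ m) n (dominatingSets G)

γSets : {n : ℕ} → Graph n → List (Subset n)
γSets G = filterᵇ (λ D → ∣ D ∣ ≡ᵇ γ G) (dominatingSets G)

DV : {n : ℕ} → Graph n → Fin n → ℕ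
DV G v = length (filterᵇ (memᵇ v) (γSets G))

C : (n : ℕ) → Graph n
C zero    ()
C (suc m) i j = ((suc (toℕ i) % suc m) ≡ᵇ toℕ j) ∨ ((suc (toℕ j) % suc m) ≡ᵇ toℕ i)

⌈_/3⌉ : ℕ → ℕ
⌈ n /3⌉ = (n + 2) / 3

-- By rotation every vertex of C_n has the same domination value, so it suffices
-- to count the γ-sets containing vertex 0. Cutting the cycle open at vertex 0, a
-- set containing it is dominating iff the word formed by the other n − 1 vertices
-- has no three consecutive non-members. Such a word with j members has length at
-- most 3j + 2, whence γ(C_n) ≥ ⌈n/3⌉. Counting these words by length, number of
-- members and length of the current run of non-members gives a recursion whose
-- values at j = ⌈n/3⌉ − 1 are 1, (k+1)(k+2)/2 and k+1 for n = 3k, 3k+1, 3k+2;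
-- being positive, they also show that ⌈n/3⌉ is attained.

module Submission where

open import Data.Bool using (Bool; true; false; T; T?; _∧_; _∨_; if_then_else_)
open import Data.Bool.Properties using (T-∧; T-∨; ∧-identityʳ; ∨-zeroʳ)
open import Data.Empty using (⊥-elim)
open import Data.Fin using (Fin; toℕ; fromℕ<) renaming (zero to fzero; suc to fsuc)
open import Data.Fin.Properties using (toℕ<n; toℕ-fromℕ<)
open import Data.Fin.Subset using (Subset; ∣_∣; inside; outside)
open import Data.List using ([]; _∷_; length; map; _++_; filterᵇ; foldr; allFin)
open import Data.List.Properties using (length-map; length-++; filter-++)
open import Data.Bool.ListAction using (any)
open import Data.List.Membership.Propositional using (_∈_; lose)
open import Data.List.Membership.Propositional.Properties using (∈-map⁺; ∈-++⁺ˡ; ∈-++⁺ʳ; ∈-filter⁺; ∈-filter⁻; ∈-allFin)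
open import Data.List.Relation.Unary.Any using (here; there; satisfied)
open import Data.List.Relation.Unary.Any.Properties using (any⁺; any⁻)
import Data.List.Relation.Unary.All as All
open import Data.List.Relation.Unary.All.Properties using (all⁺; all⁻; tabulate⁺)
open import Data.Nat using (ℕ; NonZero; zero; suc; _+_; _*_; _≤_; _<_; _⊓_; _≡ᵇ_; _<?_; z≤n; s≤s)
open import Data.Nat.Properties
open import Data.Nat.DivMod
open import Data.Nat.Divisibility using (n∣m*n)
open import Data.Nat.Tactic.RingSolver using (solve-∀)
open import Data.Product using (Σ; ∃; _×_; _,_; proj₂)
open import Data.Sum using (inj₁; inj₂)
open import Data.Vec using (Vec; []; _∷_; _∷ʳ_; lookup)
open import Function using (_∘_; Equivalence)
open import Relation.Nullary using (¬_; yes; no; contradiction)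
open import Relation.Binary.PropositionalEquality

open import Defs

open Equivalence using (to; from)

T-ext : ∀ {a b} → (T a → T b) → (T b → T a) → a ≡ b
T-ext {true}  {true}  _   _   = refl
T-ext {true}  {false} a⇒b _   = ⊥-elim (a⇒b _)
T-ext {false} {true}  _   b⇒a = ⊥-elim (b⇒a _)
T-ext {false} {false} _   _   = refl

∨-swap : ∀ a b c → a ∨ (b ∨ c) ≡ b ∨ (a ∨ c)
∨-swap true  b c = sym (∨-zeroʳ b)
∨-swap false b c = refl

¬T-∧-false : ∀ a → ¬ T (a ∧ false)
¬T-∧-false true  ()
¬T-∧-false false ()

T-∨-middle : ∀ a {b} c → T b → T (a ∨ (b ∨ c))
T-∨-middle true          c _ = _
T-∨-middle false {true}  c _ = _

count : (n : ℕ) → (Subset n → Bool) → ℕ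
count zero    P = if P [] then 1 else 0
count (suc n) P = count n (P ∘ (outside ∷_)) + count n (P ∘ (inside ∷_))

count-cong : ∀ n {P Q : Subset n → Bool} → (∀ D → P D ≡ Q D) → count n P ≡ count n Q
count-cong zero    P≗Q rewrite P≗Q [] = refl
count-cong (suc n) P≗Q =
  cong₂ _+_ (count-cong n (P≗Q ∘ (outside ∷_))) (count-cong n (P≗Q ∘ (inside ∷_)))

count-none : ∀ n {P : Subset n → Bool} → (∀ D → ¬ T (P D)) → count n P ≡ 0
count-none n ¬P = trans (count-cong n (λ D → ¬T⇒false (¬P D))) (zeros n)
  where
  ¬T⇒false : ∀ {b} → ¬ T b → b ≡ false
  ¬T⇒false {true}  ¬t = ⊥-elim (¬t _)
  ¬T⇒false {false} ¬t = refl
  zeros : ∀ n → count n (λ _ → false) ≡ 0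
  zeros zero    = refl
  zeros (suc n) = cong₂ _+_ (zeros n) (zeros n)

count-witness : ∀ n (P : Subset n → Bool) → 0 < count n P → ∃ λ D → T (P D)
count-witness zero    P pos with P [] in eq
... | true = [] , subst T (sym eq) _
count-witness (suc n) P pos with count n (P ∘ (outside ∷_)) in eq
... | suc _ = let D , PD = count-witness n _ (subst (0 <_) (sym eq) (s≤s z≤n)) in outside ∷ D , PD
... | zero  = let D , PD = count-witness n _ pos in inside ∷ D , PD

filterᵇ-map : ∀ {A B : Set} (p : B → Bool) (f : A → B) xs →
              filterᵇ p (map f xs) ≡ map f (filterᵇ (p ∘ f) xs)
filterᵇ-map p f []       = refl
filterᵇ-map p f (x ∷ xs) with p (f x)
... | true  = cong (f x ∷_) (filterᵇ-map p f xs)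
... | false = filterᵇ-map p f xs

filterᵇ-filterᵇ : ∀ {A : Set} (p q : A → Bool) xs →
                  filterᵇ q (filterᵇ p xs) ≡ filterᵇ (λ x → p x ∧ q x) xs
filterᵇ-filterᵇ p q []       = refl
filterᵇ-filterᵇ p q (x ∷ xs) with p x
... | false = filterᵇ-filterᵇ p q xs
... | true with q x
...   | true  = cong (x ∷_) (filterᵇ-filterᵇ p q xs)
...   | false = filterᵇ-filterᵇ p q xs

length-filterᵇ-allSubsets : ∀ n (P : Subset n → Bool) → length (filterᵇ P (allSubsets n)) ≡ count n P
length-filterᵇ-allSubsets zero    P with P []
... | true  = refl
... | false = refl
length-filterᵇ-allSubsets (suc n) P = begin
  length (filterᵇ P (map (outside ∷_) S ++ map (inside ∷_) S))
    ≡⟨ cong length (filter-++ _ (map (outside ∷_) S) _) ⟩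
  length (filterᵇ P (map (outside ∷_) S) ++ filterᵇ P (map (inside ∷_) S))
    ≡⟨ length-++ (filterᵇ P (map (outside ∷_) S)) ⟩
  length (filterᵇ P (map (outside ∷_) S)) + length (filterᵇ P (map (inside ∷_) S))
    ≡⟨ cong₂ _+_ (half outside) (half inside) ⟩
  count (suc n) P ∎
  where
  open ≡-Reasoning
  S = allSubsets n
  half : ∀ b → length (filterᵇ P (map (b ∷_) S)) ≡ count n (P ∘ (b ∷_))
  half b = begin
    length (filterᵇ P (map (b ∷_) S))             ≡⟨ cong length (filterᵇ-map P (b ∷_) S) ⟩
    length (map (b ∷_) (filterᵇ (P ∘ (b ∷_)) S))  ≡⟨ length-map (b ∷_) (filterᵇ (P ∘ (b ∷_)) S) ⟩
    length (filterᵇ (P ∘ (b ∷_)) S)               ≡⟨ length-filterᵇ-allSubsets n _ ⟩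
    count n (P ∘ (b ∷_))                          ∎

∈-allSubsets : ∀ {n} (D : Subset n) → D ∈ allSubsets n
∈-allSubsets         []            = here refl
∈-allSubsets {suc n} (outside ∷ D) = ∈-++⁺ˡ (∈-map⁺ (outside ∷_) (∈-allSubsets D))
∈-allSubsets {suc n} (inside  ∷ D) =
  ∈-++⁺ʳ (map (outside ∷_) (allSubsets n)) (∈-map⁺ (inside ∷_) (∈-allSubsets D))

γSetContaining : ∀ {n} → Graph n → Fin n → Subset n → Bool
γSetContaining G v D = (isDominating G D ∧ (∣ D ∣ ≡ᵇ γ G)) ∧ memᵇ v D

DV≡count : ∀ {n} (G : Graph n) v → DV G v ≡ count n (γSetContaining G v)
DV≡count {n} G v = begin
  length (filterᵇ (memᵇ v) (filterᵇ (λ D → ∣ D ∣ ≡ᵇ γ G) (filterᵇ (isDominating G) S)))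
    ≡⟨ cong (length ∘ filterᵇ (memᵇ v)) (filterᵇ-filterᵇ (isDominating G) _ S) ⟩
  length (filterᵇ (memᵇ v) (filterᵇ (λ D → isDominating G D ∧ (∣ D ∣ ≡ᵇ γ G)) S))
    ≡⟨ cong length (filterᵇ-filterᵇ _ (memᵇ v) S) ⟩
  length (filterᵇ (γSetContaining G v) S)
    ≡⟨ length-filterᵇ-allSubsets n _ ⟩
  count n (γSetContaining G v) ∎
  where
  open ≡-Reasoning
  S = allSubsets n

rotate : ∀ {A : Set} {m} → Vec A (suc m) → Vec A (suc m)
rotate (x ∷ xs) = xs ∷ʳ x

rotate^ : ∀ {A : Set} {m} → ℕ → Vec A (suc m) → Vec A (suc m)
rotate^ zero    = λ xs → xs
rotate^ (suc t) = rotate ∘ rotate^ t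

count-∷ʳ : ∀ n (P : Subset (suc n) → Bool) →
           count (suc n) P ≡ count n (P ∘ (_∷ʳ outside)) + count n (P ∘ (_∷ʳ inside))
count-∷ʳ zero    P = refl
count-∷ʳ (suc n) P = begin
  count (suc n) (P ∘ (outside ∷_)) + count (suc n) (P ∘ (inside ∷_))
    ≡⟨ cong₂ _+_ (count-∷ʳ n (P ∘ (outside ∷_))) (count-∷ʳ n (P ∘ (inside ∷_))) ⟩
  (a + b) + (c + d)
    ≡⟨ +-interchange a b c d ⟩
  (a + c) + (b + d) ∎
  where
  open ≡-Reasoning
  a = count n (λ D → P (outside ∷ (D ∷ʳ outside)))
  b = count n (λ D → P (outside ∷ (D ∷ʳ inside)))
  c = count n (λ D → P (inside ∷ (D ∷ʳ outside)))
  d = count n (λ D → P (inside ∷ (D ∷ʳ inside)))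
  +-interchange : ∀ a b c d → (a + b) + (c + d) ≡ (a + c) + (b + d)
  +-interchange = solve-∀

count-rotate^ : ∀ m t (P : Subset (suc m) → Bool) → count (suc m) (P ∘ rotate^ t) ≡ count (suc m) P
count-rotate^ m zero    P = refl
count-rotate^ m (suc t) P = trans (count-rotate^ m t (P ∘ rotate)) (sym (count-∷ʳ m P))

foldr-⊓-≤ : ∀ {A : Set} (f : A → ℕ) a {x xs} → x ∈ xs → foldr (λ y m → f y ⊓ m) a xs ≤ f x
foldr-⊓-≤ f a (here refl)    = m⊓n≤m _ _
foldr-⊓-≤ f a (there x∈xs) = ≤-trans (m⊓n≤n _ _) (foldr-⊓-≤ f a x∈xs)

≤-foldr-⊓ : ∀ {A : Set} (f : A → ℕ) {k a} xs → k ≤ a → (∀ {x} → x ∈ xs → k ≤ f x) →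
            k ≤ foldr (λ y m → f y ⊓ m) a xs
≤-foldr-⊓ f []       k≤a k≤f = k≤a
≤-foldr-⊓ f (x ∷ xs) k≤a k≤f = ⊓-glb (k≤f (here refl)) (≤-foldr-⊓ f xs k≤a (k≤f ∘ there))

module _ {n : ℕ} (G : Graph n) where

  γ≤∣D∣ : ∀ D → T (isDominating G D) → γ G ≤ ∣ D ∣
  γ≤∣D∣ D dom = foldr-⊓-≤ ∣_∣ n (∈-filter⁺ (T? ∘ isDominating G) (∈-allSubsets D) dom)

  ≤γ : ∀ {k} → k ≤ n → (∀ D → T (isDominating G D) → k ≤ ∣ D ∣) → k ≤ γ G
  ≤γ k≤n k≤dom = ≤-foldr-⊓ ∣_∣ (dominatingSets G) k≤n
    (λ {D} D∈ → k≤dom D (proj₂ (∈-filter⁻ (T? ∘ isDominating G) {xs = allSubsets n} D∈)))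

-- Reading subsets of C_n cyclically

module _ (m k n : ℕ) .{{_ : NonZero n}} where

  [m%n+k]%n≡[m+k]%n : (m % n + k) % n ≡ (m + k) % n
  [m%n+k]%n≡[m+k]%n = begin
    (m % n + k) % n          ≡⟨ %-distribˡ-+ (m % n) k n ⟩
    (m % n % n + k % n) % n  ≡⟨ cong (λ x → (x + k % n) % n) (m%n%n≡m%n m n) ⟩
    (m % n + k % n) % n      ≡⟨ %-distribˡ-+ m k n ⟨
    (m + k) % n              ∎
    where open ≡-Reasoning

  [k+m%n]%n≡[k+m]%n : (k + m % n) % n ≡ (k + m) % n
  [k+m%n]%n≡[k+m]%n = begin
    (k + m % n) % n  ≡⟨ cong (_% n) (+-comm k (m % n)) ⟩
    (m % n + k) % n  ≡⟨ [m%n+k]%n≡[m+k]%n ⟩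
    (m + k) % n      ≡⟨ cong (_% n) (+-comm m k) ⟩
    (k + m) % n      ∎
    where open ≡-Reasoning

-- Out-of-range positions read as members: for a set containing vertex 0 of a
-- cycle this is exactly the wrap-around from the last vertex back to vertex 0.
index : ∀ {n} → Vec Bool n → ℕ → Bool
index []       k       = true
index (b ∷ bs) zero    = b
index (b ∷ bs) (suc k) = index bs k

index-toℕ : ∀ {n} (D : Vec Bool n) (i : Fin n) → index D (toℕ i) ≡ lookup D i
index-toℕ (b ∷ D) fzero    = refl
index-toℕ (b ∷ D) (fsuc i) = index-toℕ D i

memᵇ≡lookup : ∀ {n} (i : Fin n) (D : Subset n) → memᵇ i D ≡ lookup D i
memᵇ≡lookup i D with lookup D i
... | inside  = refl
... | outside = refl

memᵇ≡index : ∀ {n} (i : Fin n) (D : Subset n) → memᵇ i D ≡ index D (toℕ i)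
memᵇ≡index i D = trans (memᵇ≡lookup i D) (sym (index-toℕ D i))

index-≥ : ∀ {n} (D : Vec Bool n) {k} → n ≤ k → index D k ≡ true
index-≥ []      n≤k       = refl
index-≥ (b ∷ D) (s≤s n≤k) = index-≥ D n≤k

index-∷ʳ-< : ∀ {n} (bs : Vec Bool n) b {r} → r < n → index (bs ∷ʳ b) r ≡ index bs r
index-∷ʳ-< (x ∷ bs) b {zero}  r<n       = refl
index-∷ʳ-< (x ∷ bs) b {suc r} (s≤s r<n) = index-∷ʳ-< bs b r<n

index-∷ʳ : ∀ {n} (bs : Vec Bool n) b → index (bs ∷ʳ b) n ≡ b
index-∷ʳ []       b = refl
index-∷ʳ (x ∷ bs) b = index-∷ʳ bs b

module _ {m : ℕ} where
  private
    N = suc m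

  cyc : Subset N → ℕ → Bool
  cyc D k = index D (k % N)

  cyc-% : ∀ D k → cyc D (k % N) ≡ cyc D k
  cyc-% D k = cong (index D) (m%n%n≡m%n k N)

  cyc-+N : ∀ D k → cyc D (k + N) ≡ cyc D k
  cyc-+N D k = cong (index D) ([m+n]%n≡m%n k N)

  cyc-< : ∀ D {k} → k < N → cyc D k ≡ index D k
  cyc-< D k<N = cong (index D) (m<n⇒m%n≡m k<N)

  cyc-toℕ : ∀ D (i : Fin N) → cyc D (toℕ i) ≡ lookup D i
  cyc-toℕ D i = trans (cyc-< D (toℕ<n i)) (index-toℕ D i)

  -- k + m is the predecessor of k modulo N
  dominatedAt : Subset N → ℕ → Bool
  dominatedAt D k = cyc D (k + m) ∨ (cyc D k ∨ cyc D (suc k))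

  CycDominating : Subset N → Set
  CycDominating D = ∀ k → T (dominatedAt D k)

  dominatedAt-% : ∀ D k → dominatedAt D (k % N) ≡ dominatedAt D k
  dominatedAt-% D k = cong₂ _∨_
    (cong (index D) ([m%n+k]%n≡[m+k]%n k m N))
    (cong₂ _∨_ (cyc-% D k) (cong (index D) ([k+m%n]%n≡[k+m]%n k 1 N)))

  [1+k]%N≡u⇒[u+m]%N≡k%N : ∀ {k u} → suc k % N ≡ u → (u + m) % N ≡ k % N
  [1+k]%N≡u⇒[u+m]%N≡k%N {k} refl = begin
    (suc k % N + m) % N  ≡⟨ [m%n+k]%n≡[m+k]%n (suc k) m N ⟩
    (suc k + m) % N      ≡⟨ cong (_% N) (+-suc k m) ⟨
    (k + N) % N          ≡⟨ [m+n]%n≡m%n k N ⟩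
    k % N                ∎
    where open ≡-Reasoning

  [1+[u+m]%N]%N≡u%N : ∀ u → suc ((u + m) % N) % N ≡ u % N
  [1+[u+m]%N]%N≡u%N u = begin
    (1 + (u + m) % N) % N  ≡⟨ [k+m%n]%n≡[k+m]%n (u + m) 1 N ⟩
    (1 + (u + m)) % N      ≡⟨ cong (_% N) (+-suc u m) ⟨
    (u + N) % N            ≡⟨ [m+n]%n≡m%n u N ⟩
    u % N                  ∎
    where open ≡-Reasoning

  cyc⇒member : ∀ D k → T (cyc D k) → Σ (Fin N) λ w → toℕ w ≡ k % N × T (memᵇ w D)
  cyc⇒member D k t = w , w≡k , subst T (sym (trans (memᵇ≡index w D) (cong (index D) w≡k))) t
    where
    w = fromℕ< (m%n<n k N)
    w≡k : toℕ w ≡ k % N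
    w≡k = toℕ-fromℕ< (m%n<n k N)

  any-adjacent-C : ∀ D (u : Fin N) →
    any (λ w → memᵇ w D ∧ C N u w) (allFin N) ≡ cyc D (toℕ u + m) ∨ cyc D (suc (toℕ u))
  any-adjacent-C D u = T-ext adjacent⇒ ⇒adjacent
    where
    u′ = toℕ u
    adjacent⇒ : T (any (λ w → memᵇ w D ∧ C N u w) (allFin N)) → T (cyc D (u′ + m) ∨ cyc D (suc u′))
    adjacent⇒ t with satisfied (any⁻ _ (allFin N) t)
    ... | w , Tw with to T-∧ Tw
    ... | w∈D , uw with to (T-∨ {suc u′ % N ≡ᵇ toℕ w}) uw
    ... | inj₁ u+1≡w = from T-∨ (inj₂ (subst T
          (trans (memᵇ≡index w D) (cong (index D) (sym (≡ᵇ⇒≡ _ _ u+1≡w)))) w∈D))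
    ... | inj₂ w+1≡u = from T-∨ (inj₁ (subst T
          (trans (memᵇ≡index w D) (trans (sym (cyc-< D (toℕ<n w)))
            (cong (index D) (sym ([1+k]%N≡u⇒[u+m]%N≡k%N (≡ᵇ⇒≡ _ _ w+1≡u)))))) w∈D))
    ⇒adjacent : T (cyc D (u′ + m) ∨ cyc D (suc u′)) → T (any (λ w → memᵇ w D ∧ C N u w) (allFin N))
    ⇒adjacent t with to T-∨ t
    ... | inj₂ succ = let w , w≡ , w∈D = cyc⇒member D (suc u′) succ in
      any⁺ _ (lose (∈-allFin w) (from T-∧ (w∈D , from T-∨ (inj₁ (≡⇒≡ᵇ _ _ (sym w≡))))))
    ... | inj₁ pred = let w , w≡ , w∈D = cyc⇒member D (u′ + m) pred in
      any⁺ _ (lose (∈-allFin w) (from T-∧ (w∈D , from T-∨ (inj₂ (≡⇒≡ᵇ _ _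
        (trans (cong (λ x → suc x % N) w≡) (trans ([1+[u+m]%N]%N≡u%N u′) (m<n⇒m%n≡m (toℕ<n u)))))))))

  dominatedAt-toℕ : ∀ D (u : Fin N) →
    memᵇ u D ∨ any (λ w → memᵇ w D ∧ C N u w) (allFin N) ≡ dominatedAt D (toℕ u)
  dominatedAt-toℕ D u = begin
    memᵇ u D ∨ any (λ w → memᵇ w D ∧ C N u w) (allFin N)
      ≡⟨ cong₂ _∨_ (trans (memᵇ≡lookup u D) (sym (cyc-toℕ D u))) (any-adjacent-C D u) ⟩
    cyc D (toℕ u) ∨ (cyc D (toℕ u + m) ∨ cyc D (suc (toℕ u)))
      ≡⟨ ∨-swap (cyc D (toℕ u)) (cyc D (toℕ u + m)) (cyc D (suc (toℕ u))) ⟩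
    dominatedAt D (toℕ u) ∎
    where open ≡-Reasoning

  isDominating-C⇒CycDominating : ∀ D → T (isDominating (C N) D) → CycDominating D
  isDominating-C⇒CycDominating D dom k =
    subst T (trans (dominatedAt-toℕ D u) (trans (cong (dominatedAt D) u≡k) (dominatedAt-% D k)))
      (All.lookup (all⁺ _ (allFin N) dom) (∈-allFin u))
    where
    u = fromℕ< (m%n<n k N)
    u≡k : toℕ u ≡ k % N
    u≡k = toℕ-fromℕ< (m%n<n k N)

  CycDominating⇒isDominating-C : ∀ D → CycDominating D → T (isDominating (C N) D)
  CycDominating⇒isDominating-C D dom =
    all⁻ _ (tabulate⁺ λ u → subst T (sym (dominatedAt-toℕ D u)) (dom (toℕ u)))

  dominatedAt-+N : ∀ D k → dominatedAt D (k + N) ≡ dominatedAt D k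
  dominatedAt-+N D k = begin
    dominatedAt D (k + N)        ≡⟨ dominatedAt-% D (k + N) ⟨
    dominatedAt D ((k + N) % N)  ≡⟨ cong (dominatedAt D) ([m+n]%n≡m%n k N) ⟩
    dominatedAt D (k % N)        ≡⟨ dominatedAt-% D k ⟩
    dominatedAt D k              ∎
    where open ≡-Reasoning

  cyc-rotate : ∀ D k → cyc (rotate D) k ≡ cyc D (suc k)
  cyc-rotate D k = begin
    cyc (rotate D) k        ≡⟨ cyc-% (rotate D) k ⟨
    cyc (rotate D) (k % N)  ≡⟨ cyc-rotate-< D (m%n<n k N) ⟩
    cyc D (suc (k % N))     ≡⟨ cong (index D) ([k+m%n]%n≡[k+m]%n k 1 N) ⟩
    cyc D (suc k)           ∎
    where
    open ≡-Reasoning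
    cyc-rotate-< : ∀ D {r} → r < N → cyc (rotate D) r ≡ cyc D (suc r)
    cyc-rotate-< (b ∷ bs) {r} (s≤s r≤m) with m≤n⇒m<n∨m≡n r≤m
    ... | inj₁ r<m = begin
      cyc (bs ∷ʳ b) r         ≡⟨ cyc-< (bs ∷ʳ b) (s≤s r≤m) ⟩
      index (bs ∷ʳ b) r       ≡⟨ index-∷ʳ-< bs b r<m ⟩
      index (b ∷ bs) (suc r)  ≡⟨ cyc-< (b ∷ bs) (s≤s r<m) ⟨
      cyc (b ∷ bs) (suc r)    ∎
    ... | inj₂ refl = begin
      cyc (bs ∷ʳ b) m         ≡⟨ cyc-< (bs ∷ʳ b) (s≤s r≤m) ⟩
      index (bs ∷ʳ b) m       ≡⟨ index-∷ʳ bs b ⟩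
      cyc (b ∷ bs) 0          ≡⟨ cyc-+N (b ∷ bs) 0 ⟨
      cyc (b ∷ bs) (suc m)    ∎

  dominatedAt-rotate : ∀ D k → dominatedAt (rotate D) k ≡ dominatedAt D (suc k)
  dominatedAt-rotate D k =
    cong₂ _∨_ (cyc-rotate D (k + m)) (cong₂ _∨_ (cyc-rotate D k) (cyc-rotate D (suc k)))

  isDominating-C-rotate : ∀ D → isDominating (C N) (rotate D) ≡ isDominating (C N) D
  isDominating-C-rotate D = T-ext
    (λ dom → CycDominating⇒isDominating-C D λ k →
      subst T (unrotate k) (isDominating-C⇒CycDominating (rotate D) dom (k + m)))
    (λ dom → CycDominating⇒isDominating-C (rotate D) λ k →
      subst T (sym (dominatedAt-rotate D k)) (isDominating-C⇒CycDominating D dom (suc k)))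
    where
    unrotate : ∀ k → dominatedAt (rotate D) (k + m) ≡ dominatedAt D k
    unrotate k = begin
      dominatedAt (rotate D) (k + m)  ≡⟨ dominatedAt-rotate D (k + m) ⟩
      dominatedAt D (suc (k + m))     ≡⟨ cong (dominatedAt D) (+-suc k m) ⟨
      dominatedAt D (k + N)           ≡⟨ dominatedAt-+N D k ⟩
      dominatedAt D k                 ∎
      where open ≡-Reasoning

  isDominating-C-rotate^ : ∀ t D → isDominating (C N) (rotate^ t D) ≡ isDominating (C N) D
  isDominating-C-rotate^ zero    D = refl
  isDominating-C-rotate^ (suc t) D =
    trans (isDominating-C-rotate (rotate^ t D)) (isDominating-C-rotate^ t D)

  cyc-rotate^ : ∀ t D k → cyc (rotate^ t D) k ≡ cyc D (t + k)
  cyc-rotate^ zero    D k = refl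
  cyc-rotate^ (suc t) D k =
    trans (cyc-rotate (rotate^ t D) k) (trans (cyc-rotate^ t D (suc k)) (cong (cyc D) (+-suc t k)))

∣∷ʳ∣ : ∀ {n} (xs : Subset n) x → ∣ xs ∷ʳ x ∣ ≡ ∣ x ∷ xs ∣
∣∷ʳ∣ []             x       = refl
∣∷ʳ∣ (inside  ∷ xs) inside  = cong suc (∣∷ʳ∣ xs inside)
∣∷ʳ∣ (inside  ∷ xs) outside = cong suc (∣∷ʳ∣ xs outside)
∣∷ʳ∣ (outside ∷ xs) x       = trans (∣∷ʳ∣ xs x) (skip-outside x)
  where
  skip-outside : ∀ x → ∣ x ∷ xs ∣ ≡ ∣ x ∷ outside ∷ xs ∣
  skip-outside inside  = refl
  skip-outside outside = refl

∣rotate^∣ : ∀ {m} t (D : Subset (suc m)) → ∣ rotate^ t D ∣ ≡ ∣ D ∣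
∣rotate^∣ zero    D = refl
∣rotate^∣ (suc t) D with rotate^ t D | ∣rotate^∣ t D
... | x ∷ xs | eq = trans (∣∷ʳ∣ xs x) eq

module _ {m : ℕ} where
  private
    N = suc m

  γSetContaining-rotate^ : ∀ (v : Fin N) D →
    γSetContaining (C N) v D ≡ γSetContaining (C N) fzero (rotate^ (toℕ v) D)
  γSetContaining-rotate^ v D = cong₂ _∧_
    (cong₂ _∧_ (sym (isDominating-C-rotate^ t D)) (cong (_≡ᵇ γ (C N)) (sym (∣rotate^∣ t D))))
    (begin
      memᵇ v D                        ≡⟨ memᵇ≡lookup v D ⟩
      lookup D v                      ≡⟨ cyc-toℕ D v ⟨
      cyc D t                         ≡⟨ cong (cyc D) (+-identityʳ t) ⟨
      cyc D (t + 0)                   ≡⟨ cyc-rotate^ t D 0 ⟨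
      cyc (rotate^ t D) 0             ≡⟨ cyc-toℕ (rotate^ t D) fzero ⟩
      lookup (rotate^ t D) fzero      ≡⟨ memᵇ≡lookup fzero (rotate^ t D) ⟨
      memᵇ fzero (rotate^ t D)        ∎)
    where
    open ≡-Reasoning
    t = toℕ v

  DV-C-vertexTransitive : ∀ (v : Fin N) → DV (C N) v ≡ DV (C N) fzero
  DV-C-vertexTransitive v = begin
    DV (C N) v                                      ≡⟨ DV≡count (C N) v ⟩
    count N (P v)                                   ≡⟨ count-cong N (γSetContaining-rotate^ v) ⟩
    count N (P fzero ∘ rotate^ (toℕ v))             ≡⟨ count-rotate^ m (toℕ v) (P fzero) ⟩
    count N (P fzero)                               ≡⟨ DV≡count (C N) fzero ⟨
    DV (C N) fzero                                  ∎
    where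
    open ≡-Reasoning
    P = γSetContaining (C N)

-- Dominating sets through vertex 0 as gap-free words

-- g counts the non-members read since the last member; a third consecutive
-- non-member would leave the middle one of the three undominated.
gapFree : ℕ → ∀ {n} → Vec Bool n → Bool
gapFree g             []            = true
gapFree g             (true  ∷ bs)  = gapFree 0 bs
gapFree 0             (false ∷ bs)  = gapFree 1 bs
gapFree 1             (false ∷ bs)  = gapFree 2 bs
gapFree (suc (suc g)) (false ∷ bs)  = false

window : ∀ {n} → Vec Bool n → ℕ → Bool
window xs j = index xs j ∨ (index xs (suc j) ∨ index xs (suc (suc j)))

EveryWindowMeets : ∀ {n} → Vec Bool n → Set
EveryWindowMeets xs = ∀ j → T (window xs j)

gapFree₀⇒windows : ∀ {n} (bs : Vec Bool n) → T (gapFree 0 bs) → EveryWindowMeets (true ∷ bs)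
gapFree₁⇒windows : ∀ {n} (bs : Vec Bool n) → T (gapFree 1 bs) → EveryWindowMeets (false ∷ bs)
gapFree₂⇒windows : ∀ {n} (bs : Vec Bool n) → T (gapFree 2 bs) → EveryWindowMeets (false ∷ false ∷ bs)
gapFree₀⇒windows bs           t zero          = _
gapFree₀⇒windows []           t (suc j)       = _
gapFree₀⇒windows (true  ∷ bs) t (suc j)       = gapFree₀⇒windows bs t j
gapFree₀⇒windows (false ∷ bs) t (suc j)       = gapFree₁⇒windows bs t j
gapFree₁⇒windows []           t zero          = _
gapFree₁⇒windows []           t (suc j)       = _
gapFree₁⇒windows (true  ∷ bs) t zero          = _
gapFree₁⇒windows (true  ∷ bs) t (suc j)       = gapFree₀⇒windows bs t j
gapFree₁⇒windows (false ∷ bs) t j             = gapFree₂⇒windows bs t j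
gapFree₂⇒windows []           t zero          = _
gapFree₂⇒windows []           t (suc zero)    = _
gapFree₂⇒windows []           t (suc (suc j)) = _
gapFree₂⇒windows (true  ∷ bs) t zero          = _
gapFree₂⇒windows (true  ∷ bs) t (suc zero)    = _
gapFree₂⇒windows (true  ∷ bs) t (suc (suc j)) = gapFree₀⇒windows bs t j

windows⇒gapFree₀ : ∀ {n} (bs : Vec Bool n) → EveryWindowMeets (true ∷ bs) → T (gapFree 0 bs)
windows⇒gapFree₁ : ∀ {n} (bs : Vec Bool n) → EveryWindowMeets (false ∷ bs) → T (gapFree 1 bs)
windows⇒gapFree₂ : ∀ {n} (bs : Vec Bool n) → EveryWindowMeets (false ∷ false ∷ bs) → T (gapFree 2 bs)
windows⇒gapFree₀ []           w = _
windows⇒gapFree₀ (true  ∷ bs) w = windows⇒gapFree₀ bs (w ∘ suc)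
windows⇒gapFree₀ (false ∷ bs) w = windows⇒gapFree₁ bs (w ∘ suc)
windows⇒gapFree₁ []           w = _
windows⇒gapFree₁ (true  ∷ bs) w = windows⇒gapFree₀ bs (w ∘ suc)
windows⇒gapFree₁ (false ∷ bs) w = windows⇒gapFree₂ bs w
windows⇒gapFree₂ []           w = _
windows⇒gapFree₂ (true  ∷ bs) w = windows⇒gapFree₀ bs (w ∘ suc ∘ suc)
windows⇒gapFree₂ (false ∷ bs) w = ⊥-elim (w 0)

module _ {m : ℕ} (bs : Vec Bool m) where
  private
    N = suc m
    D = inside ∷ bs

  cyc-inside∷ : ∀ {k} → k ≤ N → cyc D k ≡ index D k
  cyc-inside∷ k≤N with m≤n⇒m<n∨m≡n k≤N
  ... | inj₁ k<N = cyc-< D k<N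
  ... | inj₂ refl = trans (cyc-+N D 0) (sym (index-≥ D ≤-refl))

  dominatedAt-suc≡window : ∀ {i} → i < m → dominatedAt D (suc i) ≡ window D i
  dominatedAt-suc≡window {i} i<m = cong₂ _∨_ predecessor
    (cong₂ _∨_ (cyc-inside∷ (s≤s (<⇒≤ i<m))) (cyc-inside∷ (s≤s i<m)))
    where
    predecessor : cyc D (suc i + m) ≡ index D i
    predecessor = begin
      cyc D (suc (i + m)) ≡⟨ cong (cyc D) (+-suc i m) ⟨
      cyc D (i + N)       ≡⟨ cyc-+N D i ⟩
      cyc D i             ≡⟨ cyc-< D (s≤s (<⇒≤ i<m)) ⟩
      index D i           ∎
      where open ≡-Reasoning

  CycDominating⇒windows : CycDominating D → EveryWindowMeets D
  CycDominating⇒windows dom j with j <? m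
  ... | yes j<m = subst T (dominatedAt-suc≡window j<m) (dom (suc j))
  ... | no  j≮m = T-∨-middle (index D j) (index D (suc (suc j))) (subst T (sym (index-≥ bs (≮⇒≥ j≮m))) _)

  windows⇒CycDominating : EveryWindowMeets D → CycDominating D
  windows⇒CycDominating w k = subst T (dominatedAt-% D k) (reduced (m%n<n k N))
    where
    reduced : ∀ {r} → r < N → T (dominatedAt D r)
    reduced {zero}  _         = T-∨-middle (cyc D m) (cyc D 1) _
    reduced {suc i} (s≤s i<m) = subst T (sym (dominatedAt-suc≡window i<m)) (w i)

  isDominating-C-inside∷ : isDominating (C N) D ≡ gapFree 0 bs
  isDominating-C-inside∷ = T-ext
    (λ dom → windows⇒gapFree₀ bs (CycDominating⇒windows (isDominating-C⇒CycDominating D dom)))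
    (λ gf → CycDominating⇒isDominating-C D (windows⇒CycDominating (gapFree₀⇒windows bs gf)))

-- Counting gap-free words

gapFreeCount : ℕ → ℕ → ℕ → ℕ
gapFreeCount zero    zero    g             = 1
gapFreeCount zero    (suc j) g             = 0
gapFreeCount (suc m) zero    0             = gapFreeCount m zero 1
gapFreeCount (suc m) zero    1             = gapFreeCount m zero 2
gapFreeCount (suc m) zero    (suc (suc g)) = 0
gapFreeCount (suc m) (suc j) 0             = gapFreeCount m j 0 + gapFreeCount m (suc j) 1
gapFreeCount (suc m) (suc j) 1             = gapFreeCount m j 0 + gapFreeCount m (suc j) 2
gapFreeCount (suc m) (suc j) (suc (suc g)) = gapFreeCount m j 0

count-gapFree : ∀ m j g → count m (λ bs → gapFree g bs ∧ (∣ bs ∣ ≡ᵇ j)) ≡ gapFreeCount m j g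
count-gapFree zero    zero    g                   = refl
count-gapFree zero    (suc j) g                   = refl
count-gapFree (suc m) zero    0                   =
  trans (cong₂ _+_ (count-gapFree m 0 1) (count-none m (¬T-∧-false ∘ gapFree 0))) (+-identityʳ _)
count-gapFree (suc m) zero    1                   =
  trans (cong₂ _+_ (count-gapFree m 0 2) (count-none m (¬T-∧-false ∘ gapFree 0))) (+-identityʳ _)
count-gapFree (suc m) zero    (suc (suc g))       =
  cong₂ _+_ (count-none m (λ _ ())) (count-none m (¬T-∧-false ∘ gapFree 0))
count-gapFree (suc m) (suc j) 0                   =
  trans (+-comm (count m _) _) (cong₂ _+_ (count-gapFree m j 0) (count-gapFree m (suc j) 1))
count-gapFree (suc m) (suc j) 1                   =
  trans (+-comm (count m _) _) (cong₂ _+_ (count-gapFree m j 0) (count-gapFree m (suc j) 2))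
count-gapFree (suc m) (suc j) (suc (suc g))       =
  cong₂ _+_ (count-none m (λ _ ())) (count-gapFree m j 0)

gapFree-length : ∀ g {n} (bs : Vec Bool n) → T (gapFree g bs) → g ≤ 2 → n + g ≤ ∣ bs ∣ * 3 + 2
gapFree-length g                     []           t g≤2 = g≤2
gapFree-length g             {suc n} (true  ∷ bs) t g≤2 = begin
  suc n + g             ≤⟨ +-monoʳ-≤ (suc n) g≤2 ⟩
  suc n + 2             ≡⟨ cong suc (trans (+-suc n 1) (cong suc (+-suc n 0))) ⟩
  3 + (n + 0)           ≤⟨ +-monoʳ-≤ 3 (gapFree-length 0 bs t z≤n) ⟩
  3 + (∣ bs ∣ * 3 + 2)  ∎
  where open ≤-Reasoning
gapFree-length 0             {suc n} (false ∷ bs) t _   =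
  subst (_≤ ∣ bs ∣ * 3 + 2) (+-suc n 0) (gapFree-length 1 bs t (s≤s z≤n))
gapFree-length 1             {suc n} (false ∷ bs) t _   =
  subst (_≤ ∣ bs ∣ * 3 + 2) (+-suc n 1) (gapFree-length 2 bs t ≤-refl)
gapFree-length 2                     (false ∷ bs) ()
gapFree-length (suc (suc (suc g)))   (false ∷ bs) t (s≤s (s≤s ()))

gapFreeCount≡0 : ∀ {m} j → j * 3 + 3 ≤ m → gapFreeCount m j 0 ≡ 0
gapFreeCount≡0 {m} j 3j+3≤m = trans (sym (count-gapFree m j 0)) (count-none m impossible)
  where
  impossible : ∀ (bs : Vec Bool m) → ¬ T (gapFree 0 bs ∧ (∣ bs ∣ ≡ᵇ j))
  impossible bs t with to (T-∧ {gapFree 0 bs}) t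
  ... | gf , ∣bs∣≡j = 3≰2 (+-cancelˡ-≤ (j * 3) 3 2 (begin
    j * 3 + 3       ≤⟨ 3j+3≤m ⟩
    m               ≤⟨ m≤m+n m 0 ⟩
    m + 0           ≤⟨ gapFree-length 0 bs gf z≤n ⟩
    ∣ bs ∣ * 3 + 2  ≡⟨ cong (λ k → k * 3 + 2) (≡ᵇ⇒≡ ∣ bs ∣ j ∣bs∣≡j) ⟩
    j * 3 + 2       ∎))
    where
    open ≤-Reasoning
    3≰2 : ¬ 3 ≤ 2
    3≰2 (s≤s (s≤s ()))

gapFreeCount[2+3j,j,0]≡1 : ∀ j → gapFreeCount (2 + j * 3) j 0 ≡ 1
gapFreeCount[1+3j,j,1]≡1 : ∀ j → gapFreeCount (1 + j * 3) j 1 ≡ 1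
gapFreeCount[3j,j,2]≡1   : ∀ j → gapFreeCount (j * 3) j 2 ≡ 1
gapFreeCount[3j,j,2]≡1   zero    = refl
gapFreeCount[3j,j,2]≡1   (suc j) = gapFreeCount[2+3j,j,0]≡1 j
gapFreeCount[1+3j,j,1]≡1 zero    = refl
gapFreeCount[1+3j,j,1]≡1 (suc j) =
  cong₂ _+_ (gapFreeCount≡0 j (≤-reflexive (+-comm (j * 3) 3))) (gapFreeCount[3j,j,2]≡1 (suc j))
gapFreeCount[2+3j,j,0]≡1 zero    = refl
gapFreeCount[2+3j,j,0]≡1 (suc j) =
  cong₂ _+_ (gapFreeCount≡0 j (m≤n⇒m≤1+n (≤-reflexive (+-comm (j * 3) 3))))
            (gapFreeCount[1+3j,j,1]≡1 (suc j))

gapFreeCount[1+3j,j,0]≡1+j : ∀ j → gapFreeCount (1 + j * 3) j 0 ≡ suc j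
gapFreeCount[1+3j,j,0]≡1+j zero    = refl
gapFreeCount[1+3j,j,0]≡1+j (suc j) = cong₂ _+_ (gapFreeCount≡0 j (≤-reflexive (+-comm (j * 3) 3)))
  (cong₂ _+_ (gapFreeCount[2+3j,j,0]≡1 j) (gapFreeCount[1+3j,j,0]≡1+j j))

triangle : ℕ → ℕ
triangle zero    = 0
triangle (suc n) = suc n + triangle n

gapFreeCount[3j,j,0]≡triangle[1+j] : ∀ j → gapFreeCount (j * 3) j 0 ≡ triangle (suc j)
gapFreeCount[3j,j,0]≡triangle[1+j] zero    = refl
gapFreeCount[3j,j,0]≡triangle[1+j] (suc j) = cong₂ _+_ (gapFreeCount[2+3j,j,0]≡1 j)
  (cong₂ _+_ (gapFreeCount[1+3j,j,0]≡1+j j) (gapFreeCount[3j,j,0]≡triangle[1+j] j))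

n[1+n]/2≡triangle : ∀ n → n * (1 + n) / 2 ≡ triangle n
n[1+n]/2≡triangle n = trans (cong (_/ 2) (sym (triangle*2 n))) (m*n/n≡m (triangle n) 2)
  where
  triangle*2 : ∀ n → triangle n * 2 ≡ n * (1 + n)
  triangle*2 zero    = refl
  triangle*2 (suc n) = begin
    (suc n + triangle n) * 2      ≡⟨ *-distribʳ-+ 2 (suc n) (triangle n) ⟩
    suc n * 2 + triangle n * 2    ≡⟨ cong (suc n * 2 +_) (triangle*2 n) ⟩
    suc n * 2 + n * (1 + n)       ≡⟨ step n ⟩
    suc n * (1 + suc n)           ∎
    where
    open ≡-Reasoning
    step : ∀ n → suc n * 2 + n * (1 + n) ≡ suc n * (1 + suc n)
    step = solve-∀

⌈n/3⌉≤q : ∀ {n} q → n ≤ q * 3 → ⌈ n /3⌉ ≤ q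
⌈n/3⌉≤q {n} q n≤3q = begin
  (n + 2) / 3            ≤⟨ /-monoˡ-≤ 3 (+-monoˡ-≤ 2 n≤3q) ⟩
  (q * 3 + 2) / 3        ≡⟨ +-distrib-/-∣ˡ 2 (n∣m*n q) ⟩
  q * 3 / 3 + 0          ≡⟨ +-identityʳ _ ⟩
  q * 3 / 3              ≡⟨ m*n/n≡m q 3 ⟩
  q                      ∎
  where open ≤-Reasoning

⌈r+q*3/3⌉≡⌈r/3⌉+q : ∀ r q → ⌈ r + q * 3 /3⌉ ≡ ⌈ r /3⌉ + q
⌈r+q*3/3⌉≡⌈r/3⌉+q r q = begin
  (r + q * 3 + 2) / 3        ≡⟨ cong (_/ 3) (rearrange r (q * 3)) ⟩
  (r + 2 + q * 3) / 3        ≡⟨ +-distrib-/-∣ʳ (r + 2) (n∣m*n q) ⟩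
  (r + 2) / 3 + q * 3 / 3    ≡⟨ cong (⌈ r /3⌉ +_) (m*n/n≡m q 3) ⟩
  ⌈ r /3⌉ + q                ∎
  where
  open ≡-Reasoning
  rearrange : ∀ a b → a + b + 2 ≡ a + 2 + b
  rearrange = solve-∀

module _ {m : ℕ} where
  private
    N = suc m

  CycDominating⇒member : ∀ (D : Subset N) → CycDominating D → ∃ λ k → T (cyc D k)
  CycDominating⇒member D dom with to (T-∨ {cyc D m}) (dom 0)
  ... | inj₁ pred = m , pred
  ... | inj₂ rest with to (T-∨ {cyc D 0}) rest
  ...   | inj₁ self = 0 , self
  ...   | inj₂ succ = 1 , succ

  ⌈N/3⌉≤∣D∣ : ∀ (D : Subset N) → T (isDominating (C N) D) → ⌈ N /3⌉ ≤ ∣ D ∣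
  ⌈N/3⌉≤∣D∣ D dom with CycDominating⇒member D (isDominating-C⇒CycDominating D dom)
  ... | k , k∈D = subst (⌈ N /3⌉ ≤_) (∣rotate^∣ k D)
    (bound (rotate^ k D)
      (subst T (sym (trans (cyc-rotate^ k D 0) (cong (cyc D) (+-identityʳ k)))) k∈D)
      (subst T (sym (isDominating-C-rotate^ k D)) dom))
    where
    bound : ∀ (E : Subset N) → T (cyc E 0) → T (isDominating (C N) E) → ⌈ N /3⌉ ≤ ∣ E ∣
    bound (outside ∷ bs) ()
    bound (inside  ∷ bs) _  dom′ = ⌈n/3⌉≤q (suc ∣ bs ∣) (s≤s (subst₂ _≤_ (+-identityʳ m) (+-comm _ 2)
      (gapFree-length 0 bs (subst T (isDominating-C-inside∷ bs) dom′) z≤n)))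

  γ-C : ∀ {j} → ⌈ N /3⌉ ≡ suc j → 0 < gapFreeCount m j 0 → γ (C N) ≡ suc j
  γ-C {j} ⌈N/3⌉≡1+j pos with count-witness m _ (subst (0 <_) (sym (count-gapFree m j 0)) pos)
  ... | bs , t with to (T-∧ {gapFree 0 bs}) t
  ... | gf , ∣bs∣≡j = ≤-antisym
    (≤-trans (γ≤∣D∣ (C N) (inside ∷ bs) (subst T (sym (isDominating-C-inside∷ bs)) gf))
             (≤-reflexive (cong suc (≡ᵇ⇒≡ ∣ bs ∣ j ∣bs∣≡j))))
    (subst (_≤ γ (C N)) ⌈N/3⌉≡1+j (≤γ (C N) (⌈n/3⌉≤q N (m≤m*n N 3)) ⌈N/3⌉≤∣D∣))

  DV-C-fzero : ∀ {j} → γ (C N) ≡ suc j → DV (C N) fzero ≡ gapFreeCount m j 0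
  DV-C-fzero {j} γ≡1+j = begin
    DV (C N) fzero                                 ≡⟨ DV≡count (C N) fzero ⟩
    count N (γSetContaining (C N) fzero)           ≡⟨ cong₂ _+_ (count-none m (λ bs → ¬T-∧-false _))
                                                                 (count-cong m startsInside) ⟩
    count m (λ bs → gapFree 0 bs ∧ (∣ bs ∣ ≡ᵇ j))  ≡⟨ count-gapFree m j 0 ⟩
    gapFreeCount m j 0                             ∎
    where
    open ≡-Reasoning
    startsInside : ∀ bs → γSetContaining (C N) fzero (inside ∷ bs) ≡ gapFree 0 bs ∧ (∣ bs ∣ ≡ᵇ j)
    startsInside bs = trans (∧-identityʳ _)
      (cong₂ _∧_ (isDominating-C-inside∷ bs) (cong (suc ∣ bs ∣ ≡ᵇ_) γ≡1+j))

  DV-C : ∀ {j} (v : Fin N) → ⌈ N /3⌉ ≡ suc j → 0 < gapFreeCount m j 0 →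
         DV (C N) v ≡ gapFreeCount m j 0
  DV-C v ⌈N/3⌉≡1+j pos = trans (DV-C-vertexTransitive v) (DV-C-fzero (γ-C ⌈N/3⌉≡1+j pos))

≡suc⇒0< : ∀ {x k} → x ≡ suc k → 0 < x
≡suc⇒0< refl = s≤s z≤n

DV-C[3+3q]≡1 : ∀ {n} q → n ≡ 3 + q * 3 → (v : Fin n) → DV (C n) v ≡ 1
DV-C[3+3q]≡1 q refl v =
  trans (DV-C v (⌈r+q*3/3⌉≡⌈r/3⌉+q 3 q) (≡suc⇒0< count≡1)) count≡1
  where
  count≡1 : gapFreeCount (2 + q * 3) q 0 ≡ 1
  count≡1 = gapFreeCount[2+3j,j,0]≡1 q

DV-C[4+3q]≡⌈n/3⌉[1+⌈n/3⌉]/2 : ∀ {n} q → n ≡ 4 + q * 3 → (v : Fin n) →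
                              DV (C n) v ≡ ⌈ n /3⌉ * (1 + ⌈ n /3⌉) / 2
DV-C[4+3q]≡⌈n/3⌉[1+⌈n/3⌉]/2 {n} q refl v = begin
  DV (C n) v                            ≡⟨ DV-C v ⌈n/3⌉≡2+q (≡suc⇒0< count≡triangle) ⟩
  gapFreeCount (suc q * 3) (suc q) 0    ≡⟨ count≡triangle ⟩
  triangle (2 + q)                      ≡⟨ n[1+n]/2≡triangle (2 + q) ⟨
  (2 + q) * (1 + (2 + q)) / 2           ≡⟨ cong (λ k → k * (1 + k) / 2) ⌈n/3⌉≡2+q ⟨
  ⌈ n /3⌉ * (1 + ⌈ n /3⌉) / 2           ∎
  where
  open ≡-Reasoning
  ⌈n/3⌉≡2+q : ⌈ n /3⌉ ≡ 2 + q
  ⌈n/3⌉≡2+q = ⌈r+q*3/3⌉≡⌈r/3⌉+q 1 (suc q)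
  count≡triangle : gapFreeCount (suc q * 3) (suc q) 0 ≡ triangle (2 + q)
  count≡triangle = gapFreeCount[3j,j,0]≡triangle[1+j] (suc q)

DV-C[2+3q]≡⌈n/3⌉ : ∀ {n} q → n ≡ 2 + q * 3 → (v : Fin n) → DV (C n) v ≡ ⌈ n /3⌉
DV-C[2+3q]≡⌈n/3⌉ q refl v =
  trans (DV-C v ⌈n/3⌉≡1+q (≡suc⇒0< count≡1+q)) (trans count≡1+q (sym ⌈n/3⌉≡1+q))
  where
  ⌈n/3⌉≡1+q : ⌈ 2 + q * 3 /3⌉ ≡ 1 + q
  ⌈n/3⌉≡1+q = ⌈r+q*3/3⌉≡⌈r/3⌉+q 2 q
  count≡1+q : gapFreeCount (1 + q * 3) q 0 ≡ 1 + q
  count≡1+q = gapFreeCount[1+3j,j,0]≡1+j q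

corollary4p2 : (n : ℕ) → 3 ≤ n → (v : Fin n) →
    (n % 3 ≡ 0 → DV (C n) v ≡ 1) ×
    (n % 3 ≡ 1 → DV (C n) v ≡ (⌈ n /3⌉ * (1 + ⌈ n /3⌉)) / 2) ×
    (n % 3 ≡ 2 → DV (C n) v ≡ ⌈ n /3⌉)
corollary4p2 n 3≤n v = residue0 , residue1 , residue2
  where
  n≡r+[n/3]*3 : ∀ {r} → n % 3 ≡ r → n ≡ r + n / 3 * 3
  n≡r+[n/3]*3 refl = m≡m%n+[m/n]*n n 3

  residue0 : n % 3 ≡ 0 → DV (C n) v ≡ 1
  residue0 n%3≡0 with n / 3 | n≡r+[n/3]*3 n%3≡0
  ... | zero  | n≡0    = contradiction (subst (3 ≤_) n≡0 3≤n) λ ()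
  ... | suc q | n≡3+3q = DV-C[3+3q]≡1 q n≡3+3q v

  residue1 : n % 3 ≡ 1 → DV (C n) v ≡ (⌈ n /3⌉ * (1 + ⌈ n /3⌉)) / 2
  residue1 n%3≡1 with n / 3 | n≡r+[n/3]*3 n%3≡1
  ... | zero  | n≡1    = contradiction (subst (3 ≤_) n≡1 3≤n) λ { (s≤s ()) }
  ... | suc q | n≡4+3q = DV-C[4+3q]≡⌈n/3⌉[1+⌈n/3⌉]/2 q n≡4+3q v

  residue2 : n % 3 ≡ 2 → DV (C n) v ≡ ⌈ n /3⌉
  residue2 n%3≡2 = DV-C[2+3q]≡⌈n/3⌉ (n / 3) (n≡r+[n/3]*3 n%3≡2) v
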